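{- Let $C[\cdot]$ be a single-hole context possibly containing occurrences of $\bot$, and let $V$ be a value (a variable or an abstraction, without $\bot$). If $C[\bot]\in\mathcal A$ and $C[V]\to_{\mathsf v}N$, then there exists a value $V'$ such that $V\to_{\mathsf v}V'$ and $N=C[V']$.
   Context: $\Lambda_\bot$ is the set of $\lambda$-terms ($M::=x\mid\lambda x.M\mid MN$, up to $\alpha$-conversion) possibly containing a constant $\bot$; its values are $\bot$, variables and abstractions. Reductions on $\Lambda_\bot$: $(\beta_v)$ $(\lambda x.M)V\to M\{V/x\}$ for $V$ a value of $\Lambda_\bot$; $(\sigma_1)$ $(\lambda x.M)NP\to(\lambda x.MP)N$ if $x\notin FV(P)$; $(\sigma_3)$ $V((\lambda x.M)N)\to(\lambda x.VM)N$ if $V$ is a value, $x\notin FV(V)$. $\to_{\mathsf v}$ is the contextual closure of their union. $C[P]$ denotes replacing the hole by $P$. Approximants $\mathcal A\subseteq\Lambda_\bot$: $A::=B\mid C$; $B::=x\mid\lambda x.A\mid\bot\mid xBA_1\cdots A_k$; $C::=(\lambda x.A)(yBA_1\cdots A_k)$ ($k\ge0$). -}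

module Defs where

open import Data.Nat using (ℕ; zero; suc; _<ᵇ_; _≡ᵇ_; pred)
open import Data.Bool using (if_then_else_)
open import Data.Product using (Σ; _×_)
open import Relation.Binary.PropositionalEquality using (_≡_)

-- λ-terms with a constant ⊥, de Bruijn indices (so terms are taken up to α)
data Term : Set where
  var : ℕ → Term
  lam : Term → Term
  app : Term → Term → Term
  bot : Term

data IsValue : Term → Set where
  v-var : ∀ {n} → IsValue (var n)
  v-lam : ∀ {M} → IsValue (lam M)
  v-bot : IsValue bot

data BotFree : Term → Set where
  bf-var : ∀ {n} → BotFree (var n)
  bf-lam : ∀ {M} → BotFree M → BotFree (lam M)
  bf-app : ∀ {M N} → BotFree M → BotFree N → BotFree (app M N)

shift : ℕ → Term → Term
shift c (var n) = if n <ᵇ c then var n else var (suc n)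
shift c (lam M) = lam (shift (suc c) M)
shift c (app M N) = app (shift c M) (shift c N)
shift c bot = bot

-- subst j s M : replace index j by s, decrementing indices above j
-- (s is given relative to the context of M with index j removed)
subst : ℕ → Term → Term → Term
subst j s (var n) =
  if n ≡ᵇ j then s else (if j <ᵇ n then var (pred n) else var n)
subst j s (lam M) = lam (subst (suc j) (shift 0 s) M)
subst j s (app M N) = app (subst j s M) (subst j s N)
subst j s bot = bot

_[_] : Term → Term → Term
M [ V ] = subst 0 V M

-- one-step reduction →v : contextual closure of βv ∪ σ1 ∪ σ3
-- (the side conditions x ∉ FV(P), x ∉ FV(V) are realised by shifting)
data _→v_ : Term → Term → Set where
  βv  : ∀ {M V} → IsValue V → app (lam M) V →v (M [ V ])
  σ1  : ∀ {M N P} → app (app (lam M) N) P →v app (lam (app M (shift 0 P))) N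
  σ3  : ∀ {V M N} → IsValue V →
        app V (app (lam M) N) →v app (lam (app (shift 0 V) M)) N
  ξλ  : ∀ {M M'} → M →v M' → lam M →v lam M'
  ξl  : ∀ {M M' N} → M →v M' → app M N →v app M' N
  ξr  : ∀ {M N N'} → N →v N' → app M N →v app M N'

-- single-hole contexts (with possibly ⊥ inside); plugging captures variables
data Ctx : Set where
  hole : Ctx
  lamC : Ctx → Ctx
  appL : Ctx → Term → Ctx
  appR : Term → Ctx → Ctx

plug : Ctx → Term → Term
plug hole P = P
plug (lamC C) P = lam (plug C P)
plug (appL C N) P = app (plug C P) N
plug (appR M C) P = app M (plug C P)

-- approximants
--   A ::= B | C
--   B ::= x | λx.A | ⊥ | x B A1 ⋯ Ak
--   C ::= (λx.A)(y B A1 ⋯ Ak)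
-- IsHS t : t has the shape  x B A1 ⋯ Ak  (k ≥ 0)
data IsA : Term → Set
data IsB : Term → Set
data IsHS : Term → Set

data IsA where
  a-B : ∀ {t} → IsB t → IsA t
  a-C : ∀ {A t} → IsA A → IsHS t → IsA (app (lam A) t)

data IsB where
  b-var : ∀ {n} → IsB (var n)
  b-lam : ∀ {A} → IsA A → IsB (lam A)
  b-bot : IsB bot
  b-hs  : ∀ {t} → IsHS t → IsB t

data IsHS where
  hs-base : ∀ {x B} → IsB B → IsHS (app (var x) B)
  hs-step : ∀ {t A} → IsHS t → IsA A → IsHS (app t A)

module Submission where

-- An approximant is →v-normal and never applies ⊥. Take a redex of C[V] that
-- is not inside V. Replacing V by the value ⊥ either leaves it a redex of
-- C[⊥] (⊥ is a value too), or puts ⊥ in function position (when V was the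
-- λ of the redex); a value is never itself a redex, nor the (λx.M)N of a σ-redex.
-- Both outcomes are excluded for C[⊥] ∈ 𝒜, so the step happens inside V.

open import Defs
open import Data.Empty using (⊥-elim)
open import Data.Product using (Σ; _×_; _,_)
open import Relation.Nullary using (¬_)
open import Relation.Binary.PropositionalEquality using (_≡_; refl)

data BotApplied : Term → Set where
  here      : ∀ {N} → BotApplied (app bot N)
  under-lam : ∀ {M} → BotApplied M → BotApplied (lam M)
  in-fun    : ∀ {M N} → BotApplied M → BotApplied (app M N)
  in-arg    : ∀ {M N} → BotApplied N → BotApplied (app M N)

→v-preserves-IsValue : ∀ {V V'} → IsValue V → V →v V' → IsValue V'
→v-preserves-IsValue v-lam (ξλ _) = v-lam

hs-not-value : ∀ {t} → IsHS t → ¬ IsValue t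
hs-not-value (hs-base _) ()
hs-not-value (hs-step _ _) ()

hs-not-βredex : ∀ {M N} → ¬ IsHS (app (lam M) N)
hs-not-βredex (hs-step () _)

IsA-normal  : ∀ {t u} → IsA t → ¬ (t →v u)
IsB-normal  : ∀ {t u} → IsB t → ¬ (t →v u)
IsHS-normal : ∀ {t u} → IsHS t → ¬ (t →v u)

IsA-normal (a-B b) s = IsB-normal b s
IsA-normal (a-C a h) (βv v) = hs-not-value h v
IsA-normal (a-C a h) (σ3 _) = hs-not-βredex h
IsA-normal (a-C a h) (ξl (ξλ s)) = IsA-normal a s
IsA-normal (a-C a h) (ξr s) = IsHS-normal h s

IsB-normal (b-lam a) (ξλ s) = IsA-normal a s
IsB-normal (b-hs h) s = IsHS-normal h s

IsHS-normal (hs-base (b-hs h)) (σ3 _) = hs-not-βredex h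
IsHS-normal (hs-base b) (ξr s) = IsB-normal b s
IsHS-normal (hs-step h a) σ1 = hs-not-βredex h
IsHS-normal (hs-step h a) (σ3 v) = hs-not-value h v
IsHS-normal (hs-step h a) (ξl s) = IsHS-normal h s
IsHS-normal (hs-step h a) (ξr s) = IsA-normal a s

IsA-¬BotApplied  : ∀ {t} → IsA t → ¬ BotApplied t
IsB-¬BotApplied  : ∀ {t} → IsB t → ¬ BotApplied t
IsHS-¬BotApplied : ∀ {t} → IsHS t → ¬ BotApplied t

IsA-¬BotApplied (a-B b) p = IsB-¬BotApplied b p
IsA-¬BotApplied (a-C a h) (in-fun (under-lam p)) = IsA-¬BotApplied a p
IsA-¬BotApplied (a-C a h) (in-arg p) = IsHS-¬BotApplied h p

IsB-¬BotApplied (b-lam a) (under-lam p) = IsA-¬BotApplied a p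
IsB-¬BotApplied (b-hs h) p = IsHS-¬BotApplied h p

IsHS-¬BotApplied (hs-base b) (in-arg p) = IsB-¬BotApplied b p
IsHS-¬BotApplied (hs-step () a) here
IsHS-¬BotApplied (hs-step h a) (in-fun p) = IsHS-¬BotApplied h p
IsHS-¬BotApplied (hs-step h a) (in-arg p) = IsA-¬BotApplied a p

data PlugStep (C : Ctx) (V N : Term) : Set where
  in-hole     : ∀ {V'} → V →v V' → N ≡ plug C V' → PlugStep C V N
  reducible   : ∀ {u} → plug C bot →v u → PlugStep C V N
  bot-applied : BotApplied (plug C bot) → PlugStep C V N

PlugStep-lamC : ∀ {C V N} → PlugStep C V N → PlugStep (lamC C) V (lam N)
PlugStep-lamC (in-hole s refl) = in-hole s refl
PlugStep-lamC (reducible s) = reducible (ξλ s)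
PlugStep-lamC (bot-applied p) = bot-applied (under-lam p)

PlugStep-appL : ∀ {C V N} P → PlugStep C V N → PlugStep (appL C P) V (app N P)
PlugStep-appL P (in-hole s refl) = in-hole s refl
PlugStep-appL P (reducible s) = reducible (ξl s)
PlugStep-appL P (bot-applied p) = bot-applied (in-fun p)

PlugStep-appR : ∀ {C V N} P → PlugStep C V N → PlugStep (appR P C) V (app P N)
PlugStep-appR P (in-hole s refl) = in-hole s refl
PlugStep-appR P (reducible s) = reducible (ξr s)
PlugStep-appR P (bot-applied p) = bot-applied (in-arg p)

plug-step : ∀ C {V N} → IsValue V → plug C V →v N → PlugStep C V N
plug-step hole v s = in-hole s refl
plug-step (lamC C) v (ξλ s) = PlugStep-lamC (plug-step C v s)
plug-step (appL hole P) v (βv w) = bot-applied here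
plug-step (appL (lamC C) P) v (βv w) = reducible (βv w)
plug-step (appL hole P) () σ1
plug-step (appL (appL hole Q) P) v σ1 = bot-applied (in-fun here)
plug-step (appL (appL (lamC C) Q) P) v σ1 = reducible σ1
plug-step (appL (appR Q C) P) v σ1 = reducible σ1
plug-step (appL hole P) v (σ3 w) = bot-applied here
plug-step (appL (lamC C) P) v (σ3 w) = reducible (σ3 v-lam)
plug-step (appL C P) v (ξl s) = PlugStep-appL P (plug-step C v s)
plug-step (appL C P) v (ξr s) = reducible (ξr s)
plug-step (appR P hole) v (βv w) = reducible (βv v-bot)
plug-step (appR P (lamC C)) v (βv w) = reducible (βv v-lam)
plug-step (appR P hole) () (σ3 w)
plug-step (appR P (appL hole Q)) v (σ3 w) = bot-applied (in-arg here)
plug-step (appR P (appL (lamC C) Q)) v (σ3 w) = reducible (σ3 w)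
plug-step (appR P (appR Q C)) v (σ3 w) = reducible (σ3 w)
plug-step (appR P C) v σ1 = reducible σ1
plug-step (appR P C) v (ξl s) = reducible (ξl s)
plug-step (appR P C) v (ξr s) = PlugStep-appR P (plug-step C v s)

lemma2p4 : (C : Ctx) (V N : Term) →
    IsValue V → BotFree V →
    IsA (plug C bot) →
    plug C V →v N →
    Σ Term (λ V' → IsValue V' × (V →v V') × (N ≡ plug C V'))
lemma2p4 C V N v _ a s with plug-step C v s
... | in-hole s' refl = _ , →v-preserves-IsValue v s' , s' , refl
... | reducible s' = ⊥-elim (IsA-normal a s')
... | bot-applied p = ⊥-elim (IsA-¬BotApplied a p)
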